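{- Let $m,t,g$ be natural numbers with $m>0$. If $\mathrm{LowerBoundCoq}$ holds, i.e., there exists a list $s$ of natural numbers of length at most $m$, all of whose entries are $0$, such that $\mathrm{OnlineInfeasible}(mg+2,[\,],s)$ holds, then in the bin stretching game $\mathcal{G}(m,t,g)$ the player Adversary has a winning strategy.
   Context: Lists: $e::\ell$ denotes the list with head $e$ and tail $\ell$; $[\,]$ is the empty list. For a list $St$ of naturals, $\max(St)$ is its maximum element ($0$ for the empty list). $\mathrm{AddToBin}(St,e,b)$ is defined recursively: $\mathrm{AddToBin}([\,],e,b)=[e]$; $\mathrm{AddToBin}(x::s,e,0)=(x+e)::s$; $\mathrm{AddToBin}(x::s,e,k+1)=x::\mathrm{AddToBin}(s,e,k)$. A solution packing of a list $\ell$ is a list $P$ of exactly $m$ lists of naturals such that every natural $v$ occurs in the concatenation of $P$ at least as many times as in $\ell$, and each list of $P$ has sum at most $g$. $\mathrm{OnlineInfeasible}$ is the smallest relation on triples $(X,\ell,St)$ ($X$ natural, $\ell$ and $St$ lists of naturals) such that: (Overflow) if $t\le \max(St)$ and $\ell$ has a solution packing, then $\mathrm{OnlineInfeasible}(X,\ell,St)$ for every $X$; (Deadend) if $\mathrm{length}(St)\le m$ and there is a natural $e\ge1$ such that $\mathrm{OnlineInfeasible}(X,e::\ell,\mathrm{AddToBin}(St,e,b))$ holds for every $b<m$, then $\mathrm{OnlineInfeasible}(X+1,\ell,St)$. The game $\mathcal{G}(m,t,g)$: in rounds $i=1,2,\dots$, Adversary chooses a positive integer $e_i$ and then Algorithm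 chooses a bin $b_i\in\{0,\dots,m-1\}$ (all bins initially empty); Adversary wins if at some round $j$ some bin $b$ satisfies $\sum_{i\le j,\ b_i=b}e_i\ge t$ and the multiset $\{e_i:i\le j\}$ can be partitioned into $m$ parts each of sum at most $g$. A winning strategy for Adversary is one that wins against every behaviour of Algorithm. -}

module Defs where

open import Data.Nat using (ℕ; zero; suc; _+_; _*_; _≤_; _<_; _⊔_)
open import Data.Nat.Properties using (_≟_)
open import Data.Fin using (Fin)
open import Data.List using (List; []; _∷_; length; concat; map; foldr)
open import Data.Nat.ListAction using (sum)
open import Data.List.Relation.Unary.All using (All)
open import Data.List.Relation.Binary.Permutation.Propositional using (_↭_)
open import Data.Product using (Σ; ∃; _×_; _,_; proj₁)
open import Relation.Binary.PropositionalEquality using (_≡_)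
open import Relation.Nullary using (yes; no)

maxL : List ℕ → ℕ
maxL = foldr _⊔_ 0

occ : ℕ → List ℕ → ℕ
occ v [] = 0
occ v (x ∷ xs) with x ≟ v
... | yes _ = suc (occ v xs)
... | no  _ = occ v xs

AddToBin : List ℕ → ℕ → ℕ → List ℕ
AddToBin [] e b = e ∷ []
AddToBin (x ∷ s) e zero = (x + e) ∷ s
AddToBin (x ∷ s) e (suc k) = x ∷ AddToBin s e k

SolutionPacking : (m g : ℕ) → List ℕ → Set
SolutionPacking m g ℓ =
  Σ (List (List ℕ)) λ P →
    length P ≡ m
    × (∀ v → occ v ℓ ≤ occ v (concat P))
    × All (λ B → sum B ≤ g) P

data OnlineInfeasible (m t g : ℕ) : ℕ → List ℕ → List ℕ → Set where
  overflow : ∀ {X ℓ St} →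
    t ≤ maxL St → SolutionPacking m g ℓ →
    OnlineInfeasible m t g X ℓ St
  deadend : ∀ {X ℓ St} →
    length St ≤ m → (e : ℕ) → 1 ≤ e →
    (∀ b → b < m → OnlineInfeasible m t g X (e ∷ ℓ) (AddToBin St e b)) →
    OnlineInfeasible m t g (suc X) ℓ St

LowerBoundCoq : (m t g : ℕ) → Set
LowerBoundCoq m t g =
  Σ (List ℕ) λ s →
    length s ≤ m × All (_≡ 0) s × OnlineInfeasible m t g (m * g + 2) [] s

-- A history: the rounds played so far, most recent first;
-- each round is (item e_i , bin b_i).
History : ℕ → Set
History m = List (ℕ × Fin m)

items : ∀ {m} → History m → List ℕ
items = map proj₁

load : ∀ {m} → History m → Fin m → ℕ
load [] b = 0
load ((e , b′) ∷ h) b with Data.Fin._≟_ b′ b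
... | yes _ = e + load h b
... | no  _ = load h b

Partitionable : (m g : ℕ) → List ℕ → Set
Partitionable m g xs =
  Σ (List (List ℕ)) λ P →
    length P ≡ m × concat P ↭ xs × All (λ B → sum B ≤ g) P

AdversaryWon : (m t g : ℕ) → History m → Set
AdversaryWon m t g h =
  (Σ (Fin m) λ b → t ≤ load h b) × Partitionable m g (items h)

record AdvStrategy (m : ℕ) : Set where
  field
    next     : History m → ℕ
    positive : ∀ h → 1 ≤ next h
open AdvStrategy public

Algorithm : ℕ → Set
Algorithm m = History m → ℕ → Fin m

play : ∀ {m} → AdvStrategy m → Algorithm m → ℕ → History m
play σ A zero = []
play σ A (suc j) =
  let h = play σ A j ; e = next σ h in (e , A h e) ∷ h

WinningStrategy : (m t g : ℕ) → AdvStrategy m → Set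
WinningStrategy m t g σ =
  (A : Algorithm m) → ∃ λ j → AdversaryWon m t g (play σ A j)

AdversaryHasWinningStrategy : (m t g : ℕ) → Set
AdversaryHasWinningStrategy m t g = Σ (AdvStrategy m) (WinningStrategy m t g)

module Submission where

-- A derivation of OnlineInfeasible is a finite game tree in disguise, and the
-- theorem is proved by reading off an Adversary strategy from it.
--
-- A SolutionPacking of ℓ only has to cover every value at least
--    as often as ℓ does; deleting surplus items from its blocks (which can only
--    lower block sums) turns it into an exact partition of ℓ.
-- 2. Strategy trees.  A well-founded tree `WinsFrom h` says that Adversary, in
--    position h, has either won already or names a positive item from which it
--    wins whatever bin Algorithm picks.  The abstract bin list St of OnlineInfeasible records loads
--    of the bins used so far, in order of first use.  `Realises St h` relates it
--    to an actual history h; every real placement of Algorithm corresponds to an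
--    abstract bin b < m preserving this relation.  Following a derivation of
--    OnlineInfeasible along these correspondences builds a strategy tree: a
--    Deadend step is an Adversary move, an Overflow step is a won position.

open import Defs
open import Data.Nat using (ℕ; suc; _+_; _≤_; _<_; z≤n; s≤s)
open import Data.Nat.Properties
  using (_≟_; ≤-trans; m<m+n; ≤-reflexive; +-comm; +-identityʳ; +-monoʳ-≤; ⊔-sel)
open import Data.Nat.ListAction using (sum)
open import Data.Nat.ListAction.Properties using (sum-↭)
open import Data.Fin as Fin using (Fin; toℕ)
open import Data.Fin.Properties using (injective⇒≤; toℕ<n)
open import Data.List
  using (List; []; _∷_; [_]; _++_; length; concat; reverse; lookup; filter; take; allFin)
open import Data.List.Properties
  using (++-identityʳ; ++-assoc; reverse-++; length-tabulate; length-++; filter-accept; filter-reject)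
open import Data.List.Relation.Unary.All as All using (All; []; _∷_)
open import Data.List.Relation.Unary.Any using (here; there; index; any?)
open import Data.List.Relation.Unary.Unique.Propositional using (Unique; []; _∷_)
import Data.List.Relation.Unary.Unique.Propositional.Properties as Unique
open import Data.List.Membership.Propositional using (_∈_; _∉_)
open import Data.List.Membership.Propositional.Properties
  using (∈-++⁺ˡ; ∈-++⁺ʳ; ∈-++⁻; ∈-∃++; ∈-lookup)
open import Data.List.Relation.Binary.Permutation.Propositional using (_↭_; ↭-refl; ↭-trans; prep)
open import Data.List.Relation.Binary.Permutation.Propositional.Properties
  using (++⁺ˡ; ++⁺ʳ; shift; ↭-length; filter-↭)
open import Data.List.Relation.Binary.Pointwise as Pointwise using (Pointwise; []; _∷_)
open import Data.List.Relation.Binary.Pointwise.Properties using (Pointwise-length)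
open import Data.Product using (Σ; ∃; _×_; _,_)
open import Data.Sum using (inj₁; inj₂)
open import Function.Definitions using (Injective)
open import Relation.Nullary using (yes; no; contradiction)
open import Relation.Binary.PropositionalEquality
  using (_≡_; _≢_; refl; sym; trans; cong; subst; module ≡-Reasoning)

occ-filter : ∀ v xs → occ v xs ≡ length (filter (_≟ v) xs)
occ-filter v [] = refl
occ-filter v (x ∷ xs) with x ≟ v
... | yes x≡v = trans (cong suc (occ-filter v xs)) (sym (cong length (filter-accept (_≟ v) x≡v)))
... | no  x≢v = trans (occ-filter v xs) (sym (cong length (filter-reject (_≟ v) x≢v)))

occ-↭ : ∀ v {xs ys} → xs ↭ ys → occ v xs ≡ occ v ys
occ-↭ v {xs} {ys} p = begin
  occ v xs                     ≡⟨ occ-filter v xs ⟩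
  length (filter (_≟ v) xs)    ≡⟨ ↭-length (filter-↭ (_≟ v) p) ⟩
  length (filter (_≟ v) ys)    ≡⟨ sym (occ-filter v ys) ⟩
  occ v ys                     ∎
  where open ≡-Reasoning

occ-head : ∀ x xs → 1 ≤ occ x (x ∷ xs)
occ-head x xs with x ≟ x
... | yes _  = s≤s z≤n
... | no x≢x = contradiction refl x≢x

occ⇒∈ : ∀ v xs → 1 ≤ occ v xs → v ∈ xs
occ⇒∈ v (x ∷ xs) p with x ≟ v
... | yes refl = here refl
... | no  _    = there (occ⇒∈ v xs p)

occ-≤-tail : ∀ v x a b → occ v (x ∷ a) ≤ occ v (x ∷ b) → occ v a ≤ occ v b
occ-≤-tail v x a b p with x ≟ v
occ-≤-tail v x a b (s≤s p) | yes _ = p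
...                         | no  _ = p

_≼_ : List (List ℕ) → List (List ℕ) → Set
Q ≼ P = Pointwise (λ B′ B → sum B′ ≤ sum B) Q P

empty-≼ : ∀ P → ∃ λ Q → Q ≼ P × concat Q ≡ []
empty-≼ []      = [] , [] , refl
empty-≼ (B ∷ P) with empty-≼ P
... | Q , Q≼P , Q-empty = [] ∷ Q , z≤n ∷ Q≼P , Q-empty

data Removed (x : ℕ) : List (List ℕ) → List (List ℕ) → Set where
  here  : ∀ {B B₁ Ps} → B ↭ x ∷ B₁ → Removed x (B ∷ Ps) (B₁ ∷ Ps)
  there : ∀ {B Ps Ps₁} → Removed x Ps Ps₁ → Removed x (B ∷ Ps) (B ∷ Ps₁)

remove : ∀ {x} P → x ∈ concat P → ∃ (Removed x P)
remove (B ∷ Ps) x∈ with ∈-++⁻ B x∈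
... | inj₁ x∈B with ∈-∃++ x∈B
...   | ys , zs , refl = (ys ++ zs) ∷ Ps , here (shift _ ys zs)
remove (B ∷ Ps) x∈ | inj₂ x∈Ps with remove Ps x∈Ps
...   | Ps₁ , r = B ∷ Ps₁ , there r

removed-concat : ∀ {x P P₁} → Removed x P P₁ → concat P ↭ x ∷ concat P₁
removed-concat {P₁ = _ ∷ Ps} (here p) = ++⁺ʳ (concat Ps) p
removed-concat {P = B ∷ _} {P₁ = _ ∷ Ps₁} (there r) =
  ↭-trans (++⁺ˡ B (removed-concat r)) (shift _ B (concat Ps₁))

reinsert : ∀ {x P P₁ Q₁} → Removed x P P₁ → Q₁ ≼ P₁ →
           ∃ λ Q → Q ≼ P × concat Q ↭ x ∷ concat Q₁
reinsert {x} (here {B} {B₁} p) (_∷_ {x = B₁′} {xs = Qs} le Qs≼) =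
  (x ∷ B₁′) ∷ Qs , x+B₁′≤B ∷ Qs≼ , ↭-refl
  where
  x+B₁′≤B : x + sum B₁′ ≤ sum B
  x+B₁′≤B = ≤-trans (+-monoʳ-≤ x le) (≤-reflexive (sym (sum-↭ p)))
reinsert {x} (there r) (_∷_ {x = B′} {xs = Qs₁} le Qs₁≼) with reinsert r Qs₁≼
... | Qs , Qs≼ , p = B′ ∷ Qs , le ∷ Qs≼ , ↭-trans (++⁺ˡ B′ p) (shift x B′ (concat Qs₁))

dominated-head : ∀ {x xs ys} → (∀ v → occ v (x ∷ xs) ≤ occ v ys) → x ∈ ys
dominated-head {x} {xs} {ys} cov = occ⇒∈ x ys (≤-trans (occ-head x xs) (cov x))

dominated-removed : ∀ {x xs P P₁} → Removed x P P₁ →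
                    (∀ v → occ v (x ∷ xs) ≤ occ v (concat P)) →
                    (∀ v → occ v xs ≤ occ v (concat P₁))
dominated-removed {x} {xs} {P₁ = P₁} r cov v =
  occ-≤-tail v x xs (concat P₁) (subst (occ v (x ∷ xs) ≤_) (occ-↭ v (removed-concat r)) (cov v))

cover : ∀ xs P → (∀ v → occ v xs ≤ occ v (concat P)) →
        ∃ λ Q → Q ≼ P × concat Q ↭ xs
cover [] P _ with empty-≼ P
... | Q , Q≼P , Q-empty = Q , Q≼P , subst (_↭ []) (sym Q-empty) ↭-refl
cover (x ∷ xs) P cov with remove P (dominated-head cov)
... | P₁ , r with cover xs P₁ (dominated-removed r cov)
...   | Q₁ , Q₁≼P₁ , q₁ with reinsert r Q₁≼P₁
...     | Q , Q≼P , q = Q , Q≼P , ↭-trans q (prep x q₁)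

capacity-≼ : ∀ {g Q P} → Q ≼ P → All (λ B → sum B ≤ g) P → All (λ B → sum B ≤ g) Q
capacity-≼ []          []        = []
capacity-≼ (le ∷ Q≼P) (ok ∷ oks) = ≤-trans le ok ∷ capacity-≼ Q≼P oks

packing⇒partition : ∀ {m g ℓ} → SolutionPacking m g ℓ → Partitionable m g ℓ
packing⇒partition {ℓ = ℓ} (P , len , cov , fits) with cover ℓ P cov
... | Q , Q≼P , q = Q , trans (Pointwise-length Q≼P) len , q , capacity-≼ Q≼P fits

lookup-injective : ∀ {A : Set} {xs : List A} → Unique xs → Injective _≡_ _≡_ (lookup xs)
lookup-injective (_ ∷ _)    {Fin.zero}  {Fin.zero}  _  = refl
lookup-injective (x≢ ∷ _)   {Fin.zero}  {Fin.suc j} eq = contradiction eq (All.lookup x≢ (∈-lookup j))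
lookup-injective (x≢ ∷ _)   {Fin.suc i} {Fin.zero}  eq = contradiction (sym eq) (All.lookup x≢ (∈-lookup i))
lookup-injective (_ ∷ uniq) {Fin.suc i} {Fin.suc j} eq = cong Fin.suc (lookup-injective uniq eq)

unique-length : ∀ {m} {bs : List (Fin m)} → Unique bs → length bs ≤ m
unique-length uniq = injective⇒≤ (lookup-injective uniq)

module StrategyTrees (m t g : ℕ) where

  data WinsFrom : History m → Set where
    won  : ∀ {h} → AdversaryWon m t g h → WinsFrom h
    move : ∀ {h} (e : ℕ) → 1 ≤ e → (∀ c → WinsFrom ((e , c) ∷ h)) → WinsFrom h

  -- The item the tree prescribes after the further rounds rs (oldest first);
  -- once the game is won the choice is irrelevant and we play 1.
  prescribed : ∀ {h} → WinsFrom h → List (ℕ × Fin m) → ℕ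
  prescribed (won _)       _              = 1
  prescribed (move e _ _)  []             = e
  prescribed (move _ _ ws) ((_ , c) ∷ rs) = prescribed (ws c) rs

  prescribed-positive : ∀ {h} (w : WinsFrom h) rs → 1 ≤ prescribed w rs
  prescribed-positive (won _)        _              = s≤s z≤n
  prescribed-positive (move _ e≥1 _) []             = e≥1
  prescribed-positive (move _ _ ws)  ((_ , c) ∷ rs) = prescribed-positive (ws c) rs

  -- Histories are stored most recent first, hence the reversal.
  treeStrategy : WinsFrom [] → AdvStrategy m
  treeStrategy w = record
    { next     = λ h → prescribed w (reverse h)
    ; positive = λ h → prescribed-positive w (reverse h) }

  -- If σ follows the tree w from the position h reached after k rounds, then
  -- σ wins against A: each round descends one level in the finite tree w.
  follow : ∀ {h} (w : WinsFrom h) (σ : AdvStrategy m) (A : Algorithm m) k →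
           play σ A k ≡ h →
           (∀ rs → next σ (rs ++ h) ≡ prescribed w (reverse rs)) →
           ∃ λ j → AdversaryWon m t g (play σ A j)
  follow (won victory) σ A k reached _ = k , subst (AdversaryWon m t g) (sym reached) victory
  follow {h} (move e e≥1 ws) σ A k reached agrees =
    follow (ws c) σ A (suc k) reached′ agrees′
    where
    c : Fin m
    c = A h e
    reached′ : play σ A (suc k) ≡ (e , c) ∷ h
    reached′ rewrite reached | agrees [] = refl
    agrees′ : ∀ rs → next σ (rs ++ (e , c) ∷ h) ≡ prescribed (ws c) (reverse rs)
    agrees′ rs = begin
      next σ (rs ++ (e , c) ∷ h)
        ≡⟨ cong (next σ) (sym (++-assoc rs [ e , c ] h)) ⟩
      next σ ((rs ++ [ e , c ]) ++ h)
        ≡⟨ agrees (rs ++ [ e , c ]) ⟩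
      prescribed (move e e≥1 ws) (reverse (rs ++ [ e , c ]))
        ≡⟨ cong (prescribed (move e e≥1 ws)) (reverse-++ rs [ e , c ]) ⟩
      prescribed (ws c) (reverse rs) ∎
      where open ≡-Reasoning

  tree⇒winning : WinsFrom [] → AdversaryHasWinningStrategy m t g
  tree⇒winning w = treeStrategy w , λ A → follow w (treeStrategy w) A 0 refl
    (λ rs → cong (λ h → prescribed w (reverse h)) (++-identityʳ rs))

module Simulation (m t g : ℕ) where
  open StrategyTrees m t g

  load-same : ∀ e c (h : History m) → load ((e , c) ∷ h) c ≡ e + load h c
  load-same e c h with c Fin.≟ c
  ... | yes _  = refl
  ... | no c≢c = contradiction refl c≢c

  load-other : ∀ e c d (h : History m) → c ≢ d → load ((e , c) ∷ h) d ≡ load h d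
  load-other e c d h c≢d with c Fin.≟ d
  ... | yes c≡d = contradiction c≡d c≢d
  ... | no  _   = refl

  Loads : History m → List ℕ → List (Fin m) → Set
  Loads h = Pointwise (λ x c → x ≡ load h c)

  record Realises (St : List ℕ) (h : History m) : Set where
    field
      bins     : List (Fin m)
      distinct : Unique bins
      loads    : Loads h St bins
      empty    : ∀ c → c ∉ bins → load h c ≡ 0
  open Realises

  loads-untouched : ∀ {h e c St bs} → c ∉ bs → Loads h St bs → Loads ((e , c) ∷ h) St bs
  loads-untouched c∉ [] = []
  loads-untouched {h} {e} {c} c∉ (_∷_ {y = d} x≡ rest) =
    trans x≡ (sym (load-other e c d h (λ c≡d → c∉ (here c≡d))))
      ∷ loads-untouched (λ c∈ → c∉ (there c∈)) rest

  loads-add : ∀ {h e c St bs} → Unique bs → Loads h St bs → (c∈ : c ∈ bs) →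
              Loads ((e , c) ∷ h) (AddToBin St e (toℕ (index c∈))) bs
  loads-add {h} {e} {c} (c∉ ∷ _) (_∷_ {x = x} x≡ rest) (here refl) =
    trans (+-comm x e) (trans (cong (e +_) x≡) (sym (load-same e c h)))
      ∷ loads-untouched (λ c∈ → All.lookup c∉ c∈ refl) rest
  loads-add {h} {e} {c} (d∉ ∷ uniq) (_∷_ {y = d} x≡ rest) (there c∈) =
    trans x≡ (sym (load-other e c d h (λ { refl → All.lookup d∉ c∈ refl })))
      ∷ loads-add uniq rest c∈

  AddToBin-end : ∀ St e → AddToBin St e (length St) ≡ St ++ [ e ]
  AddToBin-end []       e = refl
  AddToBin-end (x ∷ St) e = cong (x ∷_) (AddToBin-end St e)

  place-known : ∀ {St h e c} (R : Realises St h) → c ∈ bins R →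
                Σ ℕ λ b → b < m × Realises (AddToBin St e b) ((e , c) ∷ h)
  place-known {St} {h} {e} {c} R c∈ =
    toℕ (index c∈) , b<m ,
    record { bins = bins R ; distinct = distinct R
           ; loads = loads-add (distinct R) (loads R) c∈ ; empty = empty′ }
    where
    b<m : toℕ (index c∈) < m
    b<m = ≤-trans (toℕ<n (index c∈)) (unique-length (distinct R))
    empty′ : ∀ d → d ∉ bins R → load ((e , c) ∷ h) d ≡ 0
    empty′ d d∉ = trans (load-other e c d h (λ { refl → d∉ c∈ })) (empty R d d∉)

  -- Algorithm puts e into an empty bin: St grows by one entry e.  Since the
  -- new bin list is still duplicate-free, the new position is below m.
  place-fresh : ∀ {St h e c} (R : Realises St h) → c ∉ bins R →
                Σ ℕ λ b → b < m × Realises (AddToBin St e b) ((e , c) ∷ h)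
  place-fresh {St} {h} {e} {c} R c∉ =
    length St , St<m ,
    subst (λ S → Realises S ((e , c) ∷ h)) (sym (AddToBin-end St e)) (record
      { bins = bins′ ; distinct = distinct′
      ; loads = Pointwise.++⁺ (loads-untouched c∉ (loads R)) (new-load ∷ [])
      ; empty = empty′ })
    where
    bins′ : List (Fin m)
    bins′ = bins R ++ [ c ]
    distinct′ : Unique bins′
    distinct′ = Unique.++⁺ (distinct R) (All.[] ∷ []) λ { (c∈ , here refl) → c∉ c∈ }
    St<m : length St < m
    St<m = begin-strict
      length St          ≡⟨ Pointwise-length (loads R) ⟩
      length (bins R)          <⟨ m<m+n (length (bins R)) (s≤s z≤n) ⟩
      length (bins R) + 1      ≡⟨ sym (length-++ (bins R)) ⟩
      length bins′       ≤⟨ unique-length distinct′ ⟩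
      m ∎
      where open Data.Nat.Properties.≤-Reasoning
    new-load : e ≡ load ((e , c) ∷ h) c
    new-load = sym (trans (load-same e c h) (trans (cong (e +_) (empty R c c∉)) (+-identityʳ e)))
    empty′ : ∀ d → d ∉ bins′ → load ((e , c) ∷ h) d ≡ 0
    empty′ d d∉ = trans (load-other e c d h (λ c≡d → d∉ (∈-++⁺ʳ (bins R) (here (sym c≡d)))))
                        (empty R d (λ d∈ → d∉ (∈-++⁺ˡ d∈)))

  place : ∀ {St h} → Realises St h → ∀ e c →
          Σ ℕ λ b → b < m × Realises (AddToBin St e b) ((e , c) ∷ h)
  place R e c with any? (c Fin.≟_) (bins R)
  ... | yes c∈ = place-known R c∈
  ... | no  c∉ = place-fresh R c∉

  -- An abstract bin reaching t is realised by a real bin reaching t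
  -- (for St = [] we have t = 0 and any bin c₀ will do).
  overflowing-bin : ∀ h {St bs} → Fin m → Loads h St bs → t ≤ maxL St →
                    ∃ λ c → t ≤ load h c
  overflowing-bin h c₀ [] t≤0 = c₀ , ≤-trans t≤0 z≤n
  overflowing-bin h {x ∷ St} {c ∷ _} c₀ (x≡ ∷ rest) t≤ with ⊔-sel x (maxL St)
  ... | inj₁ max≡x = c , subst (t ≤_) (trans max≡x x≡) t≤
  ... | inj₂ max≡  = overflowing-bin h c₀ rest (subst (t ≤_) max≡ t≤)

  simulate : ∀ {X ℓ St} → OnlineInfeasible m t g X ℓ St → Fin m →
             ∀ h → ℓ ≡ items h → Realises St h → WinsFrom h
  simulate (overflow t≤max packing) c₀ h ℓ≡ R =
    won (overflowing-bin h c₀ (loads R) t≤max , subst (Partitionable m g) ℓ≡ (packing⇒partition packing))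
  simulate (deadend _ e e≥1 continue) c₀ h ℓ≡ R = move e e≥1 respond
    where
    respond : ∀ c → WinsFrom ((e , c) ∷ h)
    respond c with place R e c
    ... | b , b<m , R′ = simulate (continue b b<m) c₀ ((e , c) ∷ h) (cong (e ∷_) ℓ≡) R′

  realises-zeros : ∀ s → length s ≤ m → All (_≡ 0) s → Realises s []
  realises-zeros s len zeros = record
    { bins = take (length s) (allFin m)
    ; distinct = Unique.take⁺ (length s) (Unique.allFin⁺ m)
    ; loads = zero-loads s (allFin m) (subst (length s ≤_) (sym (length-tabulate (λ i → i))) len) zeros
    ; empty = λ _ _ → refl }
    where
    zero-loads : ∀ s (bs : List (Fin m)) → length s ≤ length bs → All (_≡ 0) s →
                 Loads [] s (take (length s) bs)
    zero-loads []      _        _         []          = []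
    zero-loads (_ ∷ s) (_ ∷ bs) (s≤s len) (x≡0 ∷ zs) = x≡0 ∷ zero-loads s bs len zs

corollary1 : (m t g : ℕ) → 0 < m → LowerBoundCoq m t g → AdversaryHasWinningStrategy m t g
corollary1 m t g 0<m (s , len , zeros , infeasible) =
  tree⇒winning (simulate infeasible some-bin [] refl (realises-zeros s len zeros))
  where
  open StrategyTrees m t g
  open Simulation m t g
  some-bin : Fin m
  some-bin = Fin.fromℕ< 0<m
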